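{- Let $\{\{X_s:s\in\omega^{n+1}\}:n\in\omega\}$ be a family such that for every $n\in\omega$, $\{X_s:s\in\omega^{n+1}\}$ is a partition of $\omega$ into infinite sets, and such that $\bigcap_{i\in F}X_{s_i}$ is infinite for every finite $F\subseteq\omega$ and every choice of $s_i\in\omega^{i+1}$, $i\in F$, and let $\mathrm{Fin}'_\omega$ be the ideal on $\omega$ defined from this family as in the context. Then for any ideal $\mathcal{I}$ the following are equivalent: (a) $\mathrm{Fin}'_\omega\sqsubseteq\mathcal{I}$; (b) $\mathrm{Fin}'_\omega\leq_K\mathcal{I}$; (c) $\mathrm{Fin}^{n+1}\sqsubseteq\mathcal{I}$ for all $n\in\omega$; (d) $\mathrm{Fin}^{n+1}\leq_K\mathcal{I}$ for all $n\in\omega$.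
   Context: An ideal on a countably infinite set $X$ is a family of subsets of $X$ closed under subsets and finite unions, not containing $X$ and containing all finite subsets of $X$; write $\mathrm{dom}(\mathcal{I})=X$. $\mathrm{Fin}$ is the ideal of finite subsets of $\omega$. For $n\ge1$ the ideal $\mathrm{Fin}^n$ on $\omega^n$ is defined by $\mathrm{Fin}^1=\mathrm{Fin}$ and: $A\subseteq\omega^{n+1}$ is in $\mathrm{Fin}^{n+1}$ iff $\{i\in\omega:\{x\in\omega^n:(i,x)\in A\}\notin\mathrm{Fin}^n\}$ is finite. For $n\in\omega$, $\mathrm{Fin}^{n+2}(\{X_s:s\in\omega^{n+1}\})$ is the family of all $A\subseteq\omega$ with $\{s\in\omega^{n+1}:A\cap X_s\text{ infinite}\}\in\mathrm{Fin}^{n+1}$; $\mathrm{Fin}'_\omega$ is the ideal on $\omega$ generated by $\bigcup_{n\in\omega}\mathrm{Fin}^{n+2}(\{X_s:s\in\omega^{n+1}\})$ (sets contained in finite unions of members). For ideals $\mathcal{I},\mathcal{J}$: $\mathcal{I}\sqsubseteq\mathcal{J}$ means there is a bijection $f:\mathrm{dom}(\mathcal{J})\to\mathrm{dom}(\mathcal{I})$ with $f^{ -1}[A]\in\mathcal{J}$ for all $A\in\mathcal{I}$; $\mathcal{I}\leq_K\mathcal{J}$ (Katětov order) means there is a function (not necessarily a bijection) $f:\mathrm{dom}(\mathcal{J})\to\mathrm{dom}(\mathcal{I})$ with $f^{ -1}[A]\in\mathcal{J}$ for all $A\in\mathcal{I}$. -}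

module Defs where

open import Level using (Level; _⊔_; 0ℓ) renaming (suc to lsuc)
open import Data.Nat using (ℕ; suc)
open import Data.Fin using (Fin)
open import Data.Vec using (Vec; _∷_)
open import Data.List using (List)
open import Data.List.Membership.Propositional using (_∈_)
open import Data.Product using (Σ; _×_)
open import Data.Sum using (_⊎_)
open import Data.Unit using (⊤)
open import Relation.Nullary using (¬_)
open import Relation.Binary.PropositionalEquality using (_≡_)
open import Function.Bundles using (_⤖_; Bijection)

Subset : Set → Set₁
Subset X = X → Set

Finite : {X : Set} → Subset X → Set
Finite {X} A = Σ (List X) λ xs → ∀ x → A x → x ∈ xs

Infinite : {X : Set} → Subset X → Set
Infinite A = ¬ Finite A

-- Ideal on X (X countably infinite is imposed separately).
record IsIdeal {X : Set} (I : Subset X → Set) : Set₁ where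
  field
    down   : ∀ {A B : Subset X} → (∀ x → B x → A x) → I A → I B
    union  : ∀ {A B : Subset X} → I A → I B → I (λ x → A x ⊎ B x)
    proper : ¬ I (λ _ → ⊤)
    finite : ∀ {A : Subset X} → Finite A → I A

-- FinPow n is Fin^(n+1) on ω^(n+1) = Vec ℕ (suc n).
FinPow : (n : ℕ) → Subset (Vec ℕ (suc n)) → Set
FinPow 0 A = Finite A
FinPow (suc n) A = Finite (λ i → ¬ FinPow n (λ x → A (i ∷ x)))

_⊑_ : {Y X : Set} {ℓ₁ ℓ₂ : Level} → (Subset Y → Set ℓ₁) → (Subset X → Set ℓ₂) → Set (lsuc 0ℓ ⊔ ℓ₁ ⊔ ℓ₂)
_⊑_ {Y} {X} I J = Σ (X ⤖ Y) λ f → ∀ (A : Subset Y) → I A → J (λ x → A (Bijection.to f x))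

_≤K_ : {Y X : Set} {ℓ₁ ℓ₂ : Level} → (Subset Y → Set ℓ₁) → (Subset X → Set ℓ₂) → Set (lsuc 0ℓ ⊔ ℓ₁ ⊔ ℓ₂)
_≤K_ {Y} {X} I J = Σ (X → Y) λ f → ∀ (A : Subset Y) → I A → J (λ x → A (f x))

IsInfinitePartition : {S : Set} → (S → Subset ℕ) → Set
IsInfinitePartition {S} P =
  (∀ k → Σ S λ s → P s k × (∀ t → P t k → t ≡ s)) × (∀ s → Infinite (P s))

Family : Set₁
Family = (n : ℕ) → Vec ℕ (suc n) → Subset ℕ

-- Fin^(n+2)({X_s : s ∈ ω^(n+1)})
FinGen : Family → (n : ℕ) → Subset ℕ → Set
FinGen Xf n A = FinPow n (λ s → Infinite (λ k → A k × Xf n s k))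

Fin'ω : Family → Subset ℕ → Set₁
Fin'ω Xf A =
  Σ ℕ λ m → Σ (Fin m → ℕ) λ lvl → Σ (Fin m → Subset ℕ) λ B →
    (∀ j → FinGen Xf (lvl j) (B j)) × (∀ k → A k → Σ (Fin m) λ j → B j k)

{-# OPTIONS --safe #-}
-- Since ⊑ implies ≤K, it suffices to show Fin^(n+1) ⊑ Fin'ω and (d) ⇒ (a).
-- For the former, a back-and-forth bijection g : ω → ω^(n+2) sending each cell
-- X_s (s ∈ ω^(n+1)) into the fibre {s} × ω gives g⁻¹[A] ∈ Fin^(n+2)({X_s}) for
-- A ∈ Fin^(n+2), as g⁻¹[A] meets X_s infinitely only if the fibre A_s is infinite.
-- For (d) ⇒ (a), let f_k witness Fin^k ≤K I. Some row {x : f_2(x)(0) = i} is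
-- infinite (otherwise the image of f_2 lies in Fin²), and every row is in I.
-- Back and forth, using this row D to absorb the backward steps and the
-- finite intersection property for the forward ones, yields a bijection
-- h : dom I → ω sending each x ∉ D of index N into ⋂_{i ≤ N} X_(init f_(i+2)(x)),
-- above every last f_(i+2)(x). For a generator B of level n, h⁻¹[B] is then
-- covered by D, finitely many points, the f_(n+2)-preimage of
-- {v : B ∩ X_(init v) infinite} ∈ Fin^(n+2), and the f_(n+2)-preimage of a set
-- all of whose fibres {j : (s, j) ∈ ·} are finite.
module Submission where

open import Defs
open import Level using (0ℓ; Level; lift; lower) renaming (suc to lsuc)
open import Axiom.ExcludedMiddle using (ExcludedMiddle)
open import Data.Nat using (ℕ; zero; suc; _+_; _≤_; _<_; _≤′_; ≤′-refl; ≤′-step; _⊔_; s≤s)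
open import Data.Nat.Properties as ℕ
  using (<-irrefl; <⇒≤; ≤-<-trans; <-≤-trans; ≮⇒≥; ≤⇒≤′; m≤m⊔n; m≤n⊔m; +-suc; +-identityʳ)
open import Data.Vec using (Vec; []; _∷_; _∷ʳ_; head; tail; init; last; initLast)
open import Data.Vec.Properties using (init-∷ʳ; last-∷ʳ) renaming (≡-dec to ≡-decVec)
open import Data.List using (List; []; _∷_; map; upTo; _++_)
open import Data.List.Extrema.Nat using (max; xs≤max)
open import Data.List.Membership.Propositional using (_∈_; _∉_)
open import Data.List.Membership.Propositional.Properties using (∈-map⁺; ∈-map⁻; ∈-++⁺ˡ; ∈-++⁺ʳ; ∈-upTo⁺)
import Data.List.Membership.DecPropositional as DecMembership
open import Data.List.Relation.Binary.Subset.Propositional using (_⊆_)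
import Data.List.Relation.Binary.Subset.Propositional.Properties as Subset
open import Data.List.Relation.Unary.Any using (here; there)
open import Data.List.Relation.Unary.All using (All)
import Data.List.Relation.Unary.All as All
open import Data.Fin using (Fin) renaming (zero to fzero; suc to fsuc)
open import Data.Product using (Σ; ∃; _×_; _,_; proj₁; proj₂)
open import Data.Sum using (_⊎_; inj₁; inj₂; [_,_]′)
open import Data.Empty using (⊥-elim)
open import Relation.Nullary using (¬_; Dec; yes; no)
open import Relation.Nullary.Decidable using (map′; decidable-stable)
open import Relation.Unary using (_⊆′_; _∪_; _∩_; ⋃)
open import Relation.Binary.Definitions using (DecidableEquality)
open import Relation.Binary.PropositionalEquality using (_≡_; refl; sym; trans; cong; subst)
open import Function using (_∘_)
open import Function.Bundles using (_⤖_; _⇔_; mk⤖; mk⇔; Bijection; Inverse)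
open import Function.Definitions using (StrictlySurjective)
open import Function.Properties.Bijection using (⤖⇒↔)
open import Function.Construct.Composition using (_⤖-∘_)

Finite-⊆ : {A : Set} {P Q : Subset A} → P ⊆′ Q → Finite Q → Finite P
Finite-⊆ P⊆Q (xs , Q⊆xs) = xs , λ x p → Q⊆xs x (P⊆Q x p)

Finite-⊆-image : {A B : Set} {P : Subset A} {Q : Subset B} (f : A → B) →
                 (∀ y → Q y → ∃ λ x → P x × f x ≡ y) → Finite P → Finite Q
Finite-⊆-image f Q⊆fP (xs , P⊆xs) = map f xs , λ y q →
  let x , p , fx≡y = Q⊆fP y q in subst (_∈ map f xs) fx≡y (∈-map⁺ f (P⊆xs x p))

∈⇒<1+max : ∀ {n ns} → n ∈ ns → n < suc (max 0 ns)
∈⇒<1+max n∈ns = s≤s (All.lookup (xs≤max 0 _) n∈ns)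

1+max∉ : ∀ ns → suc (max 0 ns) ∉ ns
1+max∉ ns m = <-irrefl refl (∈⇒<1+max m)

module Classical (em : ExcludedMiddle (lsuc 0ℓ)) where

  dec : (P : Set) → Dec P
  dec P = map′ lower lift em

  dne : {P : Set} → ¬ ¬ P → P
  dne = decidable-stable (dec _)

  infinite⇒∃∉ : {A : Set} {P : Subset A} → Infinite P → ∀ xs → ∃ λ x → P x × x ∉ xs
  infinite⇒∃∉ inf xs = dne λ none → inf (xs , λ x p → dne λ x∉ → none (x , p , x∉))

  infinite⇒∃∉≥ : {P : Subset ℕ} → Infinite P → ∀ ns b → ∃ λ n → P n × n ∉ ns × b ≤ n
  infinite⇒∃∉≥ inf ns b =
    let n , p , n∉ = infinite⇒∃∉ inf (ns ++ upTo b)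
    in  n , p , n∉ ∘ ∈-++⁺ˡ , ≮⇒≥ (n∉ ∘ ∈-++⁺ʳ ns ∘ ∈-upTo⁺)

-- Cantor's enumeration of ℕ × ℕ, walking the antidiagonals from (0 , d) down to (d , 0).
nextPair : ℕ × ℕ → ℕ × ℕ
nextPair (a , zero)  = zero , suc a
nextPair (a , suc b) = suc a , b

unpair : ℕ → ℕ × ℕ
unpair zero    = zero , zero
unpair (suc k) = nextPair (unpair k)

private
  Reached : ℕ × ℕ → Set
  Reached p = ∃ λ k → unpair k ≡ p

  reached-next : ∀ {p} → Reached p → Reached (nextPair p)
  reached-next (k , refl) = suc k , refl

  reached-antidiagonal : ∀ a b → Reached (zero , a + b) → Reached (a , b)
  reached-antidiagonal zero    b r = r
  reached-antidiagonal (suc a) b r =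
    reached-next (reached-antidiagonal a (suc b) (subst (Reached ∘ (zero ,_)) (sym (+-suc a b)) r))

  reached-axis : ∀ d → Reached (zero , d)
  reached-axis zero    = zero , refl
  reached-axis (suc d) =
    reached-next (reached-antidiagonal d zero (subst (Reached ∘ (zero ,_)) (sym (+-identityʳ d)) (reached-axis d)))

unpair-surjective : StrictlySurjective _≡_ unpair
unpair-surjective (a , b) = reached-antidiagonal a b (reached-axis (a + b))

enumVec : ∀ n → ℕ → Vec ℕ (suc n)
enumVec zero    k = k ∷ []
enumVec (suc n) k = proj₁ (unpair k) ∷ enumVec n (proj₂ (unpair k))

enumVec-surjective : ∀ n → StrictlySurjective _≡_ (enumVec n)
enumVec-surjective zero    (a ∷ []) = a , refl
enumVec-surjective (suc n) (a ∷ v) with enumVec-surjective n v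
... | j , refl with unpair-surjective (a , j)
...   | k , eq = k , cong (λ p → proj₁ p ∷ enumVec n (proj₂ p)) eq

module BackAndForth
  {X Y : Set} (_≟X_ : DecidableEquality X) (_≟Y_ : DecidableEquality Y)
  (enumX : ℕ → X) (enumX-surjective : StrictlySurjective _≡_ enumX)
  (enumY : ℕ → Y) (enumY-surjective : StrictlySurjective _≡_ enumY)
  (R : X → Y → Set)
  (forth : ∀ x (ys : List Y) → ∃ λ y → R x y × y ∉ ys)
  (back  : ∀ y (xs : List X) → ∃ λ x → R x y × x ∉ xs)
  where

  open DecMembership _≟X_ using () renaming (_∈?_ to _∈X?_)
  open DecMembership _≟Y_ using () renaming (_∈?_ to _∈Y?_)

  Pairs : Set
  Pairs = List (X × Y)

  record IsMatching (ps : Pairs) : Set where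
    field
      related    : ∀ {x y} → (x , y) ∈ ps → R x y
      functional : ∀ {x y y′} → (x , y) ∈ ps → (x , y′) ∈ ps → y ≡ y′
      injective  : ∀ {x x′ y} → (x , y) ∈ ps → (x′ , y) ∈ ps → x ≡ x′

  []-matching : IsMatching []
  []-matching = record { related = λ () ; functional = λ () ; injective = λ () }

  ∷-matching : ∀ {ps x y} → IsMatching ps → R x y →
               x ∉ map proj₁ ps → y ∉ map proj₂ ps → IsMatching ((x , y) ∷ ps)
  ∷-matching {ps} {x} {y} M r x∉ y∉ = record
    { related = related′ ; functional = functional′ ; injective = injective′ }
    where
    open IsMatching M
    related′ : ∀ {a b} → (a , b) ∈ (x , y) ∷ ps → R a b
    related′ (here refl) = r
    related′ (there p)   = related p
    functional′ : ∀ {a b b′} → (a , b) ∈ (x , y) ∷ ps → (a , b′) ∈ (x , y) ∷ ps → b ≡ b′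
    functional′ (here refl) (here refl) = refl
    functional′ (here refl) (there q)   = ⊥-elim (x∉ (∈-map⁺ proj₁ q))
    functional′ (there p)   (here refl) = ⊥-elim (x∉ (∈-map⁺ proj₁ p))
    functional′ (there p)   (there q)   = functional p q
    injective′ : ∀ {a a′ b} → (a , b) ∈ (x , y) ∷ ps → (a′ , b) ∈ (x , y) ∷ ps → a ≡ a′
    injective′ (here refl) (here refl) = refl
    injective′ (here refl) (there q)   = ⊥-elim (y∉ (∈-map⁺ proj₂ q))
    injective′ (there p)   (here refl) = ⊥-elim (y∉ (∈-map⁺ proj₂ p))
    injective′ (there p)   (there q)   = injective p q

  forthStep : ℕ → Pairs → Pairs
  forthStep k ps with enumX k ∈X? map proj₁ ps
  ... | yes _ = ps
  ... | no  _ = (enumX k , proj₁ (forth (enumX k) (map proj₂ ps))) ∷ ps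

  forthStep-⊇ : ∀ k ps → ps ⊆ forthStep k ps
  forthStep-⊇ k ps with enumX k ∈X? map proj₁ ps
  ... | yes _ = λ p → p
  ... | no  _ = there

  forthStep-covers : ∀ k ps → enumX k ∈ map proj₁ (forthStep k ps)
  forthStep-covers k ps with enumX k ∈X? map proj₁ ps
  ... | yes x∈ = x∈
  ... | no  _  = here refl

  forthStep-matching : ∀ k {ps} → IsMatching ps → IsMatching (forthStep k ps)
  forthStep-matching k {ps} M with enumX k ∈X? map proj₁ ps
  ... | yes _  = M
  ... | no  x∉ = let _ , r , y∉ = forth (enumX k) (map proj₂ ps) in ∷-matching M r x∉ y∉

  backStep : ℕ → Pairs → Pairs
  backStep k ps with enumY k ∈Y? map proj₂ ps
  ... | yes _ = ps
  ... | no  _ = (proj₁ (back (enumY k) (map proj₁ ps)) , enumY k) ∷ ps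

  backStep-⊇ : ∀ k ps → ps ⊆ backStep k ps
  backStep-⊇ k ps with enumY k ∈Y? map proj₂ ps
  ... | yes _ = λ p → p
  ... | no  _ = there

  backStep-covers : ∀ k ps → enumY k ∈ map proj₂ (backStep k ps)
  backStep-covers k ps with enumY k ∈Y? map proj₂ ps
  ... | yes y∈ = y∈
  ... | no  _  = here refl

  backStep-matching : ∀ k {ps} → IsMatching ps → IsMatching (backStep k ps)
  backStep-matching k {ps} M with enumY k ∈Y? map proj₂ ps
  ... | yes _  = M
  ... | no  y∉ = let _ , r , x∉ = back (enumY k) (map proj₁ ps) in ∷-matching M r x∉ y∉

  stage : ℕ → Pairs
  stage zero    = []
  stage (suc k) = backStep k (forthStep k (stage k))

  stage-matching : ∀ k → IsMatching (stage k)
  stage-matching zero    = []-matching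
  stage-matching (suc k) = backStep-matching k (forthStep-matching k (stage-matching k))

  stage-⊆ : ∀ {i j} → i ≤′ j → stage i ⊆ stage j
  stage-⊆ ≤′-refl         p = p
  stage-⊆ (≤′-step i≤′j) p = backStep-⊇ _ _ (forthStep-⊇ _ _ (stage-⊆ i≤′j p))

  _↦_ : X → Y → Set
  x ↦ y = ∃ λ k → (x , y) ∈ stage k

  ↦-related : ∀ {x y} → x ↦ y → R x y
  ↦-related (k , p) = IsMatching.related (stage-matching k) p

  private
    joint : ∀ {i j p q} → p ∈ stage i → q ∈ stage j → p ∈ stage (i ⊔ j) × q ∈ stage (i ⊔ j)
    joint {i} {j} p q = stage-⊆ (≤⇒≤′ (m≤m⊔n i j)) p , stage-⊆ (≤⇒≤′ (m≤n⊔m i j)) q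

  ↦-functional : ∀ {x y y′} → x ↦ y → x ↦ y′ → y ≡ y′
  ↦-functional (i , p) (j , q) =
    let p′ , q′ = joint {i} {j} p q in IsMatching.functional (stage-matching (i ⊔ j)) p′ q′

  ↦-injective : ∀ {x x′ y} → x ↦ y → x′ ↦ y → x ≡ x′
  ↦-injective (i , p) (j , q) =
    let p′ , q′ = joint {i} {j} p q in IsMatching.injective (stage-matching (i ⊔ j)) p′ q′

  ↦-total : ∀ x → ∃ (x ↦_)
  ↦-total x with enumX-surjective x
  ... | k , refl with ∈-map⁻ proj₁ (Subset.map⁺ proj₁ (backStep-⊇ k _) (forthStep-covers k (stage k)))
  ...   | (_ , y) , p , refl = y , suc k , p

  ↦-surjective : ∀ y → ∃ (_↦ y)
  ↦-surjective y with enumY-surjective y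
  ... | k , refl with ∈-map⁻ proj₂ (backStep-covers k (forthStep k (stage k)))
  ...   | (x , _) , p , refl = x , suc k , p

  bijection : Σ (X ⤖ Y) λ h → ∀ x → R x (Bijection.to h x)
  bijection = mk⤖ {to = h} (h-injective , h-surjective) , λ x → ↦-related (proj₂ (↦-total x))
    where
    h : X → Y
    h x = proj₁ (↦-total x)
    h-injective : ∀ {x x′} → h x ≡ h x′ → x ≡ x′
    h-injective {x} {x′} eq = ↦-injective (proj₂ (↦-total x)) (subst (x′ ↦_) (sym eq) (proj₂ (↦-total x′)))
    h-surjective : ∀ y → ∃ λ x → ∀ {z} → z ≡ x → h z ≡ y
    h-surjective y = let x , x↦y = ↦-surjective y in x , λ { refl → ↦-functional (proj₂ (↦-total x)) x↦y }

FinPow-⊆ : ∀ n {A B : Subset (Vec ℕ (suc n))} → B ⊆′ A → FinPow n A → FinPow n B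
FinPow-⊆ zero    B⊆A = Finite-⊆ B⊆A
FinPow-⊆ (suc n) B⊆A = Finite-⊆ λ i ¬B fpA → ¬B (FinPow-⊆ n (λ x → B⊆A (i ∷ x)) fpA)

FinPow-finiteFibres : ∀ n (P : Vec ℕ (suc n) → Subset ℕ) → (∀ s → Finite (P s)) →
                      FinPow (suc n) (λ v → P (init v) (last v))
FinPow-finiteFibres zero    P fin = [] , λ i ¬fin → ⊥-elim (¬fin
  (Finite-⊆-image (_∷ []) (λ { (j ∷ []) p → j , p , refl }) (fin (i ∷ []))))
FinPow-finiteFibres (suc n) P fin = [] , λ i ¬fp → ⊥-elim (¬fp
  (FinPow-finiteFibres n (P ∘ (i ∷_)) (fin ∘ (i ∷_))))

FinPow-infiniteFibres : ∀ n (A : Subset (Vec ℕ (suc (suc n)))) →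
                        FinPow (suc n) A → FinPow n (λ s → Infinite (λ j → A (s ∷ʳ j)))
FinPow-infiniteFibres zero    A (is , p) =
  Finite-⊆-image (_∷ []) (λ { (i ∷ []) inf → i , (λ fin → inf (Finite-⊆-image head
    (λ j a → j ∷ [] , a , refl) fin)) , refl }) (is , p)
FinPow-infiniteFibres (suc n) A (is , p) = is , λ i ¬fp → p i (¬fp ∘ FinPow-infiniteFibres n (A ∘ (i ∷_)))

module _ (em : ExcludedMiddle (lsuc 0ℓ)) where
  open Classical em

  FinPow-init : ∀ n {S : Subset (Vec ℕ (suc n))} → FinPow n S → FinPow (suc n) (S ∘ init)
  FinPow-init zero    fin = Finite-⊆-image head
    (λ i ¬fin → i ∷ [] , dne (λ ¬S → ¬fin ([] , λ { (_ ∷ []) S → ⊥-elim (¬S S) })) , refl) fin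
  FinPow-init (suc n) (is , p) = is , λ i ¬fp → p i (¬fp ∘ FinPow-init n)

module _ {X : Set} {I : Subset X → Set} (ideal : IsIdeal I) where
  open IsIdeal ideal

  ideal-⋃ : ∀ m (P : Fin m → Subset X) → (∀ j → I (P j)) → I (⋃ (Fin m) P)
  ideal-⋃ zero    P P∈I = finite ([] , λ _ ())
  ideal-⋃ (suc m) P P∈I = down (λ { x (fzero , p) → inj₁ p ; x (fsuc j , p) → inj₂ (j , p) })
                               (union (P∈I fzero) (ideal-⋃ m (P ∘ fsuc) (P∈I ∘ fsuc)))

module _ {X Y Z : Set} {ℓ₁ ℓ₂ ℓ₃ : Level}
         {I : Subset Z → Set ℓ₁} {J : Subset Y → Set ℓ₂} {K : Subset X → Set ℓ₃} where

  ⊑-trans : I ⊑ J → J ⊑ K → I ⊑ K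
  ⊑-trans (f , p) (g , q) = f ⤖-∘ g , λ A A∈I → q _ (p A A∈I)

  ≤K-trans : I ≤K J → J ≤K K → I ≤K K
  ≤K-trans (f , p) (g , q) = f ∘ g , λ A A∈I → q _ (p A A∈I)

⊑⇒≤K : {X Y : Set} {ℓ₁ ℓ₂ : Level} {I : Subset Y → Set ℓ₁} {J : Subset X → Set ℓ₂} →
       I ⊑ J → I ≤K J
⊑⇒≤K (f , p) = Bijection.to f , p

module Cells {S : Set} {P : S → Subset ℕ} (partition : IsInfinitePartition P) where

  cell : ℕ → S
  cell k = proj₁ (proj₁ partition k)

  ∈-cell : ∀ k → P (cell k) k
  ∈-cell k = proj₁ (proj₂ (proj₁ partition k))

  cell-unique : ∀ {k s} → P s k → s ≡ cell k
  cell-unique {k} {s} = proj₂ (proj₂ (proj₁ partition k)) s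

InfiniteIntersections : Family → Set
InfiniteIntersections Xf =
  ∀ (F : List ℕ) (s : (i : ℕ) → Vec ℕ (suc i)) → Infinite (λ k → All (λ i → Xf i (s i) k) F)

FinGen⇒Fin'ω : ∀ Xf n {B} → FinGen Xf n B → Fin'ω Xf B
FinGen⇒Fin'ω Xf n {B} g = 1 , (λ _ → n) , (λ _ → B) , (λ _ → g) , λ k b → fzero , b

FinPow⊑Fin'ω : ExcludedMiddle (lsuc 0ℓ) → (Xf : Family) → (∀ n → IsInfinitePartition (Xf n)) →
               ∀ n → FinPow n ⊑ Fin'ω Xf
FinPow⊑Fin'ω em Xf partition zero =
  mk⤖ {to = _∷ []} (cong head , λ { (k ∷ []) → k , λ { refl → refl } }) ,
  λ A fin → FinGen⇒Fin'ω Xf 0 ([] , λ s inf → ⊥-elim (inf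
    (Finite-⊆-image head (λ k p → k ∷ [] , proj₁ p , refl) fin)))
FinPow⊑Fin'ω em Xf partition (suc m) =
  g , λ A A∈ → FinGen⇒Fin'ω Xf m (FinPow-⊆ m (meets⇒infiniteFibre A) (FinPow-infiniteFibres m A A∈))
  where
  open Classical em
  open Cells (partition m)

  forth : ∀ k vs → ∃ λ v → Xf m (init v) k × v ∉ vs
  forth k vs = cell k ∷ʳ j , subst (λ s → Xf m s k) (sym (init-∷ʳ j (cell k))) (∈-cell k) ,
               λ v∈ → 1+max∉ (map last vs) (subst (_∈ map last vs) (last-∷ʳ j (cell k)) (∈-map⁺ last v∈))
    where j = suc (max 0 (map last vs))

  back : ∀ v ks → ∃ λ k → Xf m (init v) k × k ∉ ks
  back v = infinite⇒∃∉ (proj₂ (partition m) (init v))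

  module Matching = BackAndForth ℕ._≟_ (≡-decVec ℕ._≟_) (λ k → k) (λ k → k , refl)
                                 (enumVec (suc m)) (enumVec-surjective (suc m)) (λ k v → Xf m (init v) k) forth back

  g : ℕ ⤖ Vec ℕ (suc (suc m))
  g = proj₁ Matching.bijection

  g-cell : ∀ k → Xf m (init (Bijection.to g k)) k
  g-cell = proj₂ Matching.bijection

  open Inverse (⤖⇒↔ g) using (to; from; strictlyInverseʳ)

  g-fibre : ∀ {k s} → Xf m s k → to k ≡ s ∷ʳ last (to k)
  g-fibre {k} k∈Xs = trans (proj₂ (proj₂ (initLast (to k))))
                           (cong (_∷ʳ last (to k)) (trans (cell-unique (g-cell k)) (sym (cell-unique k∈Xs))))

  meets⇒infiniteFibre : ∀ A s → Infinite ((λ k → A (to k)) ∩ Xf m s) → Infinite (λ j → A (s ∷ʳ j))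
  meets⇒infiniteFibre A s inf fin = inf (Finite-⊆-image (from ∘ (s ∷ʳ_))
    (λ k (a , k∈Xs) → last (to k) , subst A (g-fibre k∈Xs) a ,
                      trans (cong from (sym (g-fibre k∈Xs))) (strictlyInverseʳ k)) fin)

module FromKatětov
  (em : ExcludedMiddle (lsuc 0ℓ)) (Xf : Family)
  (intersections : InfiniteIntersections Xf)
  {X : Set} (eX : X ⤖ ℕ) {I : Subset X → Set} (ideal : IsIdeal I)
  (f : ∀ n → X → Vec ℕ (suc n)) (f-Katětov : ∀ n A → FinPow n A → I (A ∘ f n))
  where

  open Classical em
  open IsIdeal ideal
  open Inverse (⤖⇒↔ eX) using (to; from; strictlyInverseʳ)

  row : ℕ → Subset X
  row i x = head (f 1 x) ≡ i

  row∈I : ∀ i → I (row i)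
  row∈I i = f-Katětov 1 (λ v → head v ≡ i) (i ∷ [] , λ i′ ¬fin → only-i i′ ¬fin)
    where
    only-i : ∀ i′ → ¬ Finite (λ (_ : Vec ℕ 1) → i′ ≡ i) → i′ ∈ i ∷ []
    only-i i′ ¬fin with i′ ℕ.≟ i
    ... | yes i′≡i = here i′≡i
    ... | no  i′≢i = ⊥-elim (¬fin ([] , λ _ i′≡i → ⊥-elim (i′≢i i′≡i)))

  ∃infinite-row : ∃ λ i → Infinite (row i)
  ∃infinite-row = dne λ none → proper (down (λ x _ → x , refl)
    (f-Katětov 1 image ([] , λ i ¬fin → ⊥-elim (¬fin (image-row i none)))))
    where
    image : Subset (Vec ℕ 2)
    image v = ∃ λ x → f 1 x ≡ v
    image-row : ∀ i → ¬ (∃ λ i → Infinite (row i)) → Finite (λ w → image (i ∷ w))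
    image-row i none = Finite-⊆-image (tail ∘ f 1) (λ w (x , fx≡iw) → x , cong head fx≡iw , cong tail fx≡iw)
                                       (dne λ inf → none (i , inf))

  D : Subset X
  D = row (proj₁ ∃infinite-row)

  Adapted : X → ℕ → Set
  Adapted x y = ∀ i → i ≤ to x → Xf i (init (f (suc i) x)) y × last (f (suc i) x) ≤ y

  ∃adapted : ∀ x ns → ∃ λ y → Adapted x y × y ∉ ns
  ∃adapted x ns =
    let y , y∈cells , y∉ , bound≤y = infinite⇒∃∉≥ (intersections levels (λ i → init (f (suc i) x))) ns
                                                  (suc (max 0 (map lastAt levels)))
    in  y , (λ i i≤ → All.lookup y∈cells (level∈ i≤) ,
                      <⇒≤ (<-≤-trans (∈⇒<1+max (∈-map⁺ lastAt (level∈ i≤))) bound≤y)) , y∉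
    where
    levels : List ℕ
    levels = upTo (suc (to x))
    lastAt : ℕ → ℕ
    lastAt i = last (f (suc i) x)
    level∈ : ∀ {i} → i ≤ to x → i ∈ levels
    level∈ i≤ = ∈-upTo⁺ (s≤s i≤)

  adapted : Σ (X ⤖ ℕ) λ h → ∀ x → D x ⊎ Adapted x (Bijection.to h x)
  adapted = BackAndForth.bijection (ℕ.eq? (Bijection.injection eX)) ℕ._≟_
                                   from (λ x → to x , strictlyInverseʳ x) (λ k → k) (λ k → k , refl)
                                   (λ x y → D x ⊎ Adapted x y) forth back
    where
    forth : ∀ x ns → ∃ λ y → (D x ⊎ Adapted x y) × y ∉ ns
    forth x ns = let y , a , y∉ = ∃adapted x ns in y , inj₂ a , y∉
    back : ∀ y xs → ∃ λ x → (D x ⊎ Adapted x y) × x ∉ xs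
    back y xs = let x , Dx , x∉ = infinite⇒∃∉ (proj₂ ∃infinite-row) xs in x , inj₁ Dx , x∉

  h : X ⤖ ℕ
  h = proj₁ adapted

  FinGen-preimage : ∀ n B → FinGen Xf n B → I (B ∘ Bijection.to h)
  FinGen-preimage n B B∈ =
    down cover (union (row∈I (proj₁ ∃infinite-row)) (union (finite small-finite)
               (union (f-Katětov (suc n) (Meets ∘ init) (FinPow-init em n B∈))
                      (f-Katětov (suc n) (λ v → Below (init v) (last v))
                                 (FinPow-finiteFibres n Below below-finite)))))
    where
    Meets : Subset (Vec ℕ (suc n))
    Meets s = Infinite (B ∩ Xf n s)

    Below : Vec ℕ (suc n) → Subset ℕ
    Below s j = ∃ λ k → (B ∩ Xf n s) k × j ≤ k × Finite (B ∩ Xf n s)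

    below-finite : ∀ s → Finite (Below s)
    below-finite s with dec (Finite (B ∩ Xf n s))
    ... | yes (ks , ks-complete) = upTo (suc (max 0 ks)) , λ j (k , k∈ , j≤k , _) →
                                     ∈-upTo⁺ (≤-<-trans j≤k (∈⇒<1+max (ks-complete k k∈)))
    ... | no  infinite = [] , λ j (_ , _ , _ , fin) → ⊥-elim (infinite fin)

    Small MeetsAt BelowAt : Subset X
    Small   x = to x < n
    MeetsAt x = Meets (init (f (suc n) x))
    BelowAt x = Below (init (f (suc n) x)) (last (f (suc n) x))

    small-finite : Finite Small
    small-finite = Finite-⊆-image from (λ x x< → to x , x< , strictlyInverseʳ x) (upTo n , λ _ → ∈-upTo⁺)

    cover : B ∘ Bijection.to h ⊆′ D ∪ Small ∪ MeetsAt ∪ BelowAt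
    cover x b = [ inj₁ , inj₂ ∘ by-level (n ℕ.≤? to x) ]′ (proj₂ adapted x)
      where
      by-level : Dec (n ≤ to x) → Adapted x (Bijection.to h x) → (Small ∪ MeetsAt ∪ BelowAt) x
      by-level (no  n≰) _ = inj₁ (ℕ.≰⇒> n≰)
      by-level (yes n≤) a = inj₂ (by-meets (dec (MeetsAt x)))
        where
        by-meets : Dec (MeetsAt x) → (MeetsAt ∪ BelowAt) x
        by-meets (yes meets) = inj₁ meets
        by-meets (no  thin)  = inj₂ (_ , (b , proj₁ (a n n≤)) , proj₂ (a n n≤) , dne thin)

  Fin'ω-preimage : ∀ A → Fin'ω Xf A → I (A ∘ Bijection.to h)
  Fin'ω-preimage A (m , level , B , B∈ , A⊆) =
    down (λ x → A⊆ _)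
         (ideal-⋃ ideal m (λ j → B j ∘ Bijection.to h) (λ j → FinGen-preimage (level j) (B j) (B∈ j)))

Katětov⇒⊑ : ExcludedMiddle (lsuc 0ℓ) → (Xf : Family) →
  InfiniteIntersections Xf → {X : Set} → X ⤖ ℕ → {I : Subset X → Set} → IsIdeal I →
  (∀ n → FinPow n ≤K I) → Fin'ω Xf ⊑ I
Katětov⇒⊑ em Xf intersections eX ideal K = h , Fin'ω-preimage
  where open FromKatětov em Xf intersections eX ideal (proj₁ ∘ K) (proj₂ ∘ K)

theorem5p1 : ExcludedMiddle (lsuc 0ℓ) →
    (Xf : Family) →
    (∀ n → IsInfinitePartition (Xf n)) →
    (∀ (F : List ℕ) (s : (i : ℕ) → Vec ℕ (suc i)) → Infinite (λ k → All (λ i → Xf i (s i) k) F)) →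
    (X : Set) → X ⤖ ℕ → (I : Subset X → Set) → IsIdeal I →
    ((Fin'ω Xf ⊑ I) ⇔ (Fin'ω Xf ≤K I))
    × ((Fin'ω Xf ⊑ I) ⇔ (∀ n → FinPow n ⊑ I))
    × ((Fin'ω Xf ⊑ I) ⇔ (∀ n → FinPow n ≤K I))
theorem5p1 em Xf partition intersections X eX I ideal =
  mk⇔ a⇒b (d⇒a ∘ b⇒d) , mk⇔ a⇒c (d⇒a ∘ c⇒d) , mk⇔ (b⇒d ∘ a⇒b) d⇒a
  where
  FinPow⊑ : ∀ n → FinPow n ⊑ Fin'ω Xf
  FinPow⊑ = FinPow⊑Fin'ω em Xf partition

  a⇒b : Fin'ω Xf ⊑ I → Fin'ω Xf ≤K I
  a⇒b = ⊑⇒≤K {I = Fin'ω Xf} {J = I}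

  a⇒c : Fin'ω Xf ⊑ I → ∀ n → FinPow n ⊑ I
  a⇒c a n = ⊑-trans {I = FinPow n} {J = Fin'ω Xf} {K = I} (FinPow⊑ n) a

  b⇒d : Fin'ω Xf ≤K I → ∀ n → FinPow n ≤K I
  b⇒d b n = ≤K-trans {I = FinPow n} {J = Fin'ω Xf} {K = I}
                     (⊑⇒≤K {I = FinPow n} {J = Fin'ω Xf} (FinPow⊑ n)) b

  c⇒d : (∀ n → FinPow n ⊑ I) → ∀ n → FinPow n ≤K I
  c⇒d c n = ⊑⇒≤K {I = FinPow n} {J = I} (c n)

  d⇒a : (∀ n → FinPow n ≤K I) → Fin'ω Xf ⊑ I
  d⇒a = Katětov⇒⊑ em Xf intersections eX ideal
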